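{- Let $G$ be a chordal graph. The following are equivalent: (i) for every induced subgraph $G'$ of $G$ and every two members $S_i, S_j$ ($i\neq j$) of the multiset $\mathbf{S}(G')$, we have $S_i\cap S_j\neq\emptyset$; (ii) $G$ is $(P_4, 2P_3)$-free.
   Context: Graphs are simple, finite and undirected; a graph is chordal if it has no induced cycle of length at least four. A clique is a maximal set of pairwise adjacent vertices. A clique tree of a connected chordal graph $G$ is a tree $\mathcal{T}$ whose vertices are the cliques of $G$ such that for any two cliques $C_1,C_2$, every clique on the path from $C_1$ to $C_2$ in $\mathcal{T}$ contains $C_1\cap C_2$; every connected chordal graph has a clique tree. Each edge of a clique tree is labeled by the intersection of its two endpoint cliques; these labels are exactly the minimal vertex separators. $\mathbf{S}(G)$ denotes the multiset of edge labels of a clique tree (taken over all connected components of $G$); this multiset does not depend on the choice of clique tree. $P_4$ is the path on four vertices and $2P_3$ is the disjoint union of two paths on three vertices. A graph is $\mathcal{F}$-free if it has no induced subgraph isomorphic to a member of $\mathcal{F}$. -}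

module Defs where

open import Data.Nat using (ℕ; zero; suc; _≤_; _≡ᵇ_)
open import Data.Bool using (Bool; true; false; _∨_; _∧_)
open import Data.Fin using (Fin; toℕ)
open import Data.Fin.Subset using (Subset; _∈_; _∉_; _⊆_; _∩_; Nonempty)
open import Data.List using (List; []; _∷_)
open import Data.List.Relation.Unary.Unique.Propositional using (Unique)
import Data.List.Membership.Propositional as LM
open import Data.Product using (Σ; ∃; _×_; _,_)
open import Data.Sum using (_⊎_)
open import Relation.Binary.PropositionalEquality using (_≡_; _≢_)
open import Relation.Nullary using (¬_)
open import Function.Definitions using (Injective)
open import Function.Bundles using (_⇔_)

record Graph (n : ℕ) : Set where
  field
    adj    : Fin n → Fin n → Bool
    sym    : ∀ i j → adj i j ≡ adj j i
    irrefl : ∀ i → adj i i ≡ false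
open Graph public

-- The induced subgraph of G on the image of an injective map f : Fin k → Fin n
-- (every induced subgraph of G arises this way, up to isomorphism).
induced : ∀ {n k} → Graph n → (Fin k → Fin n) → Graph k
induced G f = record
  { adj = λ i j → adj G (f i) (f j)
  ; sym = λ i j → sym G (f i) (f j)
  ; irrefl = λ i → irrefl G (f i) }

ContainsInduced : ∀ {n k} → Graph n → (Fin k → Fin k → Bool) → Set
ContainsInduced {n} {k} G H =
  Σ (Fin k → Fin n) λ f → Injective _≡_ _≡_ f × (∀ i j → adj G (f i) (f j) ≡ H i j)

cycleAdj : (k : ℕ) → Fin k → Fin k → Bool
cycleAdj k i j =
  (suc (toℕ i) ≡ᵇ toℕ j) ∨ (suc (toℕ j) ≡ᵇ toℕ i)
  ∨ ((toℕ i ≡ᵇ 0) ∧ (suc (toℕ j) ≡ᵇ k))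
  ∨ ((toℕ j ≡ᵇ 0) ∧ (suc (toℕ i) ≡ᵇ k))

Chordal : ∀ {n} → Graph n → Set
Chordal G = ∀ k → 4 ≤ k → ¬ ContainsInduced G (cycleAdj k)

P4Adj : Fin 4 → Fin 4 → Bool
P4Adj i j = (suc (toℕ i) ≡ᵇ toℕ j) ∨ (suc (toℕ j) ≡ᵇ toℕ i)

twoP3Adj : Fin 6 → Fin 6 → Bool
twoP3Adj i j = e (toℕ i) (toℕ j) ∨ e (toℕ j) (toℕ i)
  where
  e : ℕ → ℕ → Bool
  e 0 1 = true
  e 1 2 = true
  e 3 4 = true
  e 4 5 = true
  e _ _ = false

P4-2P3-Free : ∀ {n} → Graph n → Set
P4-2P3-Free G = ¬ ContainsInduced G P4Adj × ¬ ContainsInduced G twoP3Adj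

data Walk {m : ℕ} (A : Fin m → Fin m → Bool) : Fin m → Fin m → List (Fin m) → Set where
  here : ∀ i → Walk A i i (i ∷ [])
  step : ∀ {i j k vs} → A i j ≡ true → Walk A j k vs → Walk A i k (i ∷ vs)

IsPath : ∀ {m} → (Fin m → Fin m → Bool) → Fin m → Fin m → List (Fin m) → Set
IsPath A i j vs = Walk A i j vs × Unique vs

Connected : ∀ {m} → (Fin m → Fin m → Bool) → Fin m → Fin m → Set
Connected A i j = ∃ λ vs → Walk A i j vs

IsForest : ∀ {m} → Graph m → Set
IsForest T = ∀ i j vs ws → IsPath (adj T) i j vs → IsPath (adj T) i j ws → vs ≡ ws

IsClique : ∀ {n} → Graph n → Subset n → Set
IsClique G K =
  Nonempty K
  × (∀ x y → x ∈ K → y ∈ K → x ≢ y → adj G x y ≡ true)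
  × (∀ v → v ∉ K → ¬ (∀ x → x ∈ K → adj G v x ≡ true))

-- Clique forest of a chordal graph G: a clique tree for each connected
-- component of G, taken together.  Its vertices are indexed by Fin m,
-- listing each clique of G exactly once.

record CliqueForest {n : ℕ} (G : Graph n) : Set where
  field
    m        : ℕ
    clique   : Fin m → Subset n
    isClique : ∀ i → IsClique G (clique i)
    injective : Injective _≡_ _≡_ clique
    complete : ∀ K → IsClique G K → ∃ λ i → clique i ≡ K
    tree     : Graph m
    forest   : IsForest tree
    components : ∀ i j → Connected (adj tree) i j ⇔
                   (∃ λ x → ∃ λ y → x ∈ clique i × y ∈ clique j × Connected (adj G) x y)
    pathProp : ∀ i j vs → IsPath (adj tree) i j vs → ∀ l → l LM.∈ vs →
                 (clique i ∩ clique j) ⊆ clique l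
open CliqueForest public

label : ∀ {n} {G : Graph n} → (T : CliqueForest G) → Fin (m T) → Fin (m T) → Subset n
label T a b = clique T a ∩ clique T b

DistinctEdges : ∀ {m} → Fin m → Fin m → Fin m → Fin m → Set
DistinctEdges a b c d = ¬ ((a ≡ c × b ≡ d) ⊎ (a ≡ d × b ≡ c))

-- Any two distinct members of the multiset S(G) (edge labels of a clique
-- forest) intersect.  (S(G) does not depend on the choice of clique forest.)
SeparatorsPairwiseIntersect : ∀ {n} → Graph n → Set
SeparatorsPairwiseIntersect G =
  (T : CliqueForest G) → ∀ a b c d →
    adj (tree T) a b ≡ true → adj (tree T) c d ≡ true → DistinctEdges a b c d →
    Nonempty (label T a b ∩ label T c d)

ConditionI : ∀ {n} → Graph n → Set
ConditionI {n} G =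
  ∀ k (f : Fin k → Fin n) → Injective _≡_ _≡_ f → SeparatorsPairwiseIntersect (induced G f)

module Submission where

-- (ii) ⇒ (i).  An induced subgraph H is {P4, C4, 2P3}-free (C4 is excluded by
-- chordality).  In a {P4, C4}-free graph every component has a dominating
-- vertex u (take a vertex of maximal closed neighbourhood); u lies in every
-- clique of its component, hence in the labels of all clique-forest edges there.
-- So two edges with disjoint labels lie in different components, and each edge
-- {K, L} yields an induced P3 (private vertex of K) - u - (non-neighbour in L);
-- the two P3s form an induced 2P3.
--
-- (i) ⇒ (ii).  P4 and 2P3 have clique forests with two edges of disjoint labels.  Clique forests transfer along equal adjacency, so
-- an induced copy of P4 or 2P3 in G violates (i).

open import Defs
open import Data.Nat using (ℕ)
open import Data.Nat.Properties using (≤-refl)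
open import Data.Bool using (Bool; true; false)
open import Data.Bool.Properties using (¬-not) renaming (_≟_ to _≟ᵇ_)
open import Data.Fin using (Fin; _<_)
open import Data.Fin.Patterns using (0F; 1F; 2F; 3F)
open import Data.Fin.Properties using (_≟_; _<?_; <-cmp; all?; any?)
open import Data.Fin.Subset using (Subset; _∈_; _∉_; _⊆_; _⊂_; _⊃_; _∩_; Nonempty)
open import Data.Fin.Subset.Properties
  using (_∈?_; _⊆?_; nonempty?; anySubset?; ⊆-antisym; x∈p∩q⁺; x∈p∩q⁻; p∩q⊆p; p∩q⊆q)
open import Data.Fin.Subset.Induction using (⊃-wellFounded)
open import Data.Vec using (Vec; tabulate; lookup; []; _∷_)
import Data.Vec.Properties as Vec
open import Data.List using (List; []; _∷_; filter; cartesianProduct; allFin)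
open import Data.List.Relation.Unary.All using (All; []; _∷_)
import Data.List.Relation.Unary.All as All
open import Data.List.Relation.Unary.AllPairs using (_∷_)
open import Data.List.Relation.Unary.Any using (here; there)
import Data.List.Membership.Propositional as List
open import Data.List.Membership.Propositional.Properties using (∈-filter⁺; ∈-cartesianProduct⁺; ∈-allFin)
open import Data.Product using (∃; ∃₂; _×_; _,_; proj₁; proj₂)
open import Data.Sum using (_⊎_; inj₁; inj₂)
open import Data.Empty using (⊥; ⊥-elim)
open import Function using (_∘_)
open import Function.Bundles using (_⇔_; mk⇔; Equivalence)
open import Function.Definitions using (Injective)
open import Induction.WellFounded using (Acc; acc)
open import Relation.Binary.Definitions using (tri<; tri≈; tri>)
open import Relation.Binary.PropositionalEquality using (_≡_; _≢_; refl; trans; subst) renaming (sym to ≡-sym)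
open import Relation.Nullary using (¬_; Dec; yes; no; does; ¬¬-excluded-middle)
open import Relation.Nullary.Decidable
  using (True; toWitness; from-no; map′; dec-true; decidable-stable; _×-dec_; _⊎-dec_; _→-dec_; ¬?)
open import Relation.Unary using (Decidable)

true≢false : ∀ {b} → b ≡ true → b ≡ false → ⊥
true≢false refl ()

Realises : ∀ {n} → Graph n → Bool → Fin n → Fin n → Set
Realises G true  x y = adj G x y ≡ true
Realises G false x y = adj G x y ≡ false × x ≢ y

adjacent⇒distinct : ∀ {n} (G : Graph n) {x y} → adj G x y ≡ true → x ≢ y
adjacent⇒distinct G {x} xy refl = true≢false xy (irrefl G x)

apart-sym : ∀ {n} (G : Graph n) {x y} → Realises G false x y → Realises G false y x
apart-sym G {x} {y} (xy , x≢y) = trans (sym G y x) xy , λ y≡x → x≢y (≡-sym y≡x)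

realises-adj : ∀ {n} (G : Graph n) b {x y} → Realises G b x y → adj G x y ≡ b
realises-adj G true  r = r
realises-adj G false r = proj₁ r

realises-distinct : ∀ {n} (G : Graph n) b {x y} → Realises G b x y → x ≢ y
realises-distinct G true  r = adjacent⇒distinct G r
realises-distinct G false r = proj₂ r

orderedPairs : (k : ℕ) → List (Fin k × Fin k)
orderedPairs k = filter (λ p → proj₁ p <? proj₂ p) (cartesianProduct (allFin k) (allFin k))

-- A map realising the pattern P on every ordered pair is an induced copy of P:
-- symmetry and irreflexivity take care of the remaining pairs.
embed : ∀ {n k} (G : Graph n) (P : Graph k) (f : Fin k → Fin n) →
        All (λ p → Realises G (adj P (proj₁ p) (proj₂ p)) (f (proj₁ p)) (f (proj₂ p))) (orderedPairs k) →
        ContainsInduced G (adj P)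
embed {k = k} G P f realised = f , f-injective , agrees
  where
  A = adj P

  below : ∀ {i j} → i < j → Realises G (A i j) (f i) (f j)
  below {i} {j} i<j = All.lookup realised
    (∈-filter⁺ (λ p → proj₁ p <? proj₂ p) (∈-cartesianProduct⁺ (∈-allFin i) (∈-allFin j)) i<j)

  agrees : ∀ i j → adj G (f i) (f j) ≡ A i j
  agrees i j with <-cmp i j
  ... | tri< i<j _ _ = realises-adj G (A i j) (below i<j)
  ... | tri≈ _ refl _ = trans (irrefl G (f i)) (≡-sym (irrefl P i))
  ... | tri> _ _ j<i = trans (sym G (f i) (f j)) (trans (realises-adj G (A j i) (below j<i)) (sym P j i))

  f-injective : ∀ {i j} → f i ≡ f j → i ≡ j
  f-injective {i} {j} fi≡fj with <-cmp i j
  ... | tri< i<j _ _ = ⊥-elim (realises-distinct G (A i j) (below i<j) fi≡fj)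
  ... | tri≈ _ i≡j _ = i≡j
  ... | tri> _ _ j<i = ⊥-elim (realises-distinct G (A j i) (below j<i) (≡-sym fi≡fj))

graphOf : ∀ {k} (A : Fin k → Fin k → Bool) →
          {_ : True (all? λ i → all? λ j → A i j ≟ᵇ A j i)} → {_ : True (all? λ i → A i i ≟ᵇ false)} →
          Graph k
graphOf A {symmetric} {loopless} =
  record { adj = A ; sym = toWitness symmetric ; irrefl = toWitness loopless }

matrixAdj : ∀ {k} → Vec (Vec Bool k) k → Fin k → Fin k → Bool
matrixAdj M i j = lookup (lookup M i) j

P4-graph : Graph 4
P4-graph = graphOf P4Adj

C4-graph : Graph 4
C4-graph = graphOf (cycleAdj 4)

2P3-graph : Graph 6
2P3-graph = graphOf twoP3Adj

module _ {m : ℕ} {A : Fin m → Fin m → Bool} where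

  connected-refl : ∀ {i} → Connected A i i
  connected-refl {i} = _ , here i

  connected-edge : ∀ {i j} → A i j ≡ true → Connected A i j
  connected-edge {j = j} e = _ , step e (here j)

  connected-trans : ∀ {i j l} → Connected A i j → Connected A j l → Connected A i l
  connected-trans (_ , here _)       c = c
  connected-trans (_ , step e w) c with connected-trans (_ , w) c
  ... | _ , w′ = _ , step e w′

  connected-sym : (∀ i j → A i j ≡ A j i) → ∀ {i j} → Connected A i j → Connected A j i
  connected-sym A-sym (_ , here _) = connected-refl
  connected-sym A-sym (_ , step {i} {j} e w) =
    connected-trans (connected-sym A-sym (_ , w)) (connected-edge (trans (A-sym j i) e))

  boundary-edge : ∀ {P : Fin m → Set} → Decidable P → ∀ {s y vs} → Walk A s y vs → P s → ¬ P y →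
                  ∃₂ λ x w → P x × A x w ≡ true × ¬ P w
  boundary-edge P? (here _) Ps ¬Py = ⊥-elim (¬Py Ps)
  boundary-edge P? (step {j = s′} e w) Ps ¬Py with P? s′
  ... | yes Ps′ = boundary-edge P? w Ps′ ¬Py
  ... | no ¬Ps′ = _ , s′ , Ps , e , ¬Ps′

subsetOf : ∀ {n} {P : Fin n → Set} → Decidable P → Subset n
subsetOf P? = tabulate λ y → does (P? y)

module _ {n} {P : Fin n → Set} (P? : Decidable P) where

  ∈-subsetOf⁺ : ∀ {y} → P y → y ∈ subsetOf P?
  ∈-subsetOf⁺ {y} Py = Vec.lookup⇒[]= y _ (trans (Vec.lookup∘tabulate _ y) (dec-true (P? y) Py))

  ∈-subsetOf⁻ : ∀ {y} → y ∈ subsetOf P? → P y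
  ∈-subsetOf⁻ {y} y∈ = witness (P? y) (trans (≡-sym (Vec.lookup∘tabulate _ y)) (Vec.[]=⇒lookup y∈))
    where
    witness : (d : Dec (P y)) → does d ≡ true → P y
    witness (yes Py) _ = Py
    witness (no _)  ()

module Cliques {n} (G : Graph n) where

  clique-connected : ∀ {K x y} → IsClique G K → x ∈ K → y ∈ K → Connected (adj G) x y
  clique-connected {x = x} {y} (_ , pairwise , _) x∈K y∈K with x ≟ y
  ... | yes refl = connected-refl
  ... | no x≢y   = connected-edge (pairwise x y x∈K y∈K x≢y)

  non-neighbour-in : ∀ {K p} → IsClique G K → p ∉ K → ∃ λ x → x ∈ K × adj G p x ≡ false
  non-neighbour-in {K} {p} (_ , _ , maximal) p∉K
    with any? (λ x → (x ∈? K) ×-dec ¬? (adj G p x ≟ᵇ true))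
  ... | yes (x , x∈K , ¬px) = x , x∈K , ¬-not ¬px
  ... | no none = ⊥-elim (maximal p p∉K all-adjacent)
    where
    all-adjacent : ∀ x → x ∈ K → adj G p x ≡ true
    all-adjacent x x∈K = decidable-stable (adj G p x ≟ᵇ true) λ ¬px → none (x , x∈K , ¬px)

  clique-⊆ : ∀ {K L} → IsClique G K → IsClique G L → K ⊆ L → K ≡ L
  clique-⊆ {K} {L} cK cL K⊆L = ⊆-antisym K⊆L L⊆K
    where
    L⊆K : L ⊆ K
    L⊆K {q} q∈L = decidable-stable (q ∈? K) λ q∉K →
      let (x , x∈K , qx) = non-neighbour-in cK q∉K
      in true≢false (proj₁ (proj₂ cL) q x q∈L (K⊆L x∈K) λ q≡x → q∉K (subst (_∈ K) (≡-sym q≡x) x∈K)) qx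

  private-vertex : ∀ {K L} → IsClique G K → IsClique G L → K ≢ L → ∃ λ p → p ∈ K × p ∉ L
  private-vertex {K} {L} cK cL K≢L = decidable-stable (any? λ p → (p ∈? K) ×-dec ¬? (p ∈? L)) λ none →
    K≢L (clique-⊆ cK cL λ {p} p∈K → decidable-stable (p ∈? L) λ p∉L → none (p , p∈K , p∉L))

  record InducedP3Within (S : Fin n → Set) : Set where
    field
      p u x : Fin n
      p∈S   : S p
      u∈S   : S u
      x∈S   : S x
      pu    : adj G p u ≡ true
      ux    : adj G u x ≡ true
      px    : Realises G false p x

  -- Two distinct cliques through a common vertex u give an induced P3 through u:
  -- a private vertex p of the first, u, and a non-neighbour x of p in the second.
  separating-P3 : ∀ {S K L u} → IsClique G K → IsClique G L → K ≢ L → u ∈ K → u ∈ L →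
                  (∀ {y} → y ∈ K → S y) → (∀ {y} → y ∈ L → S y) → InducedP3Within S
  separating-P3 {u = u} cK cL K≢L u∈K u∈L K⊆S L⊆S with private-vertex cK cL K≢L
  ... | p , p∈K , p∉L with non-neighbour-in cL p∉L
  ...   | x , x∈L , px = record
    { p = p ; u = u ; x = x ; p∈S = K⊆S p∈K ; u∈S = K⊆S u∈K ; x∈S = L⊆S x∈L
    ; pu = pu ; ux = ux ; px = px , λ { refl → p∉L x∈L } }
    where
    pu : adj G p u ≡ true
    pu = proj₁ (proj₂ cK) p u p∈K u∈K λ { refl → p∉L u∈L }
    ux : adj G u x ≡ true
    ux = proj₁ (proj₂ cL) u x u∈L x∈L λ { refl → true≢false pu px }

  two-P3s : ∀ {S S′ : Fin n → Set} → (∀ {s t} → S s → S′ t → Realises G false s t) →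
            InducedP3Within S → InducedP3Within S′ → ContainsInduced G twoP3Adj
  two-P3s apart P Q =
    embed G 2P3-graph (lookup (P.p ∷ P.u ∷ P.x ∷ Q.p ∷ Q.u ∷ Q.x ∷ []))
      (P.pu ∷ P.px ∷ apart P.p∈S Q.p∈S ∷ apart P.p∈S Q.u∈S ∷ apart P.p∈S Q.x∈S ∷
       P.ux ∷ apart P.u∈S Q.p∈S ∷ apart P.u∈S Q.u∈S ∷ apart P.u∈S Q.x∈S ∷
       apart P.x∈S Q.p∈S ∷ apart P.x∈S Q.u∈S ∷ apart P.x∈S Q.x∈S ∷
       Q.pu ∷ Q.px ∷ Q.ux ∷ [])
    where
    module P = InducedP3Within P
    module Q = InducedP3Within Q

module Neighbourhoods {n} (G : Graph n) where

  Near : Fin n → Fin n → Set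
  Near v y = v ≡ y ⊎ adj G v y ≡ true

  near? : ∀ v y → Dec (Near v y)
  near? v y = (v ≟ y) ⊎-dec (adj G v y ≟ᵇ true)

  N[_] : Fin n → Subset n
  N[ v ] = subsetOf (near? v)

  near⇒connected : ∀ {s t} → Near s t → Connected (adj G) s t
  near⇒connected (inj₁ refl) = connected-refl
  near⇒connected (inj₂ st)   = connected-edge st

  ¬near⇒apart : ∀ {s t} → ¬ Near s t → Realises G false s t
  ¬near⇒apart ¬st = ¬-not (λ st → ¬st (inj₂ st)) , λ s≡t → ¬st (inj₁ s≡t)

  Dominates : Fin n → Fin n → Set
  Dominates u z = ∀ y → Connected (adj G) z y → Near u y

  dominator-in-clique : ∀ {u z K} → Dominates u z → IsClique G K →
                        (∃ λ y → y ∈ K × Connected (adj G) z y) → u ∈ K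
  dominator-in-clique {u} {z} {K} dom cK (y , y∈K , zy) with u ∈? K
  ... | yes u∈K = u∈K
  ... | no u∉K  = ⊥-elim (proj₂ (proj₂ cK) u u∉K adjacent-to-K)
    where
    adjacent-to-K : ∀ x → x ∈ K → adj G u x ≡ true
    adjacent-to-K x x∈K with dom x (connected-trans zy (Cliques.clique-connected G cK y∈K x∈K))
    ... | inj₁ refl = ⊥-elim (u∉K x∈K)
    ... | inj₂ ux   = ux

-- In a graph without induced P4 and C4 every component has a dominating vertex:
-- a vertex v of maximal closed neighbourhood dominates, for otherwise an edge
-- x - w leaving N[v] gives either a larger N[x] or an induced P4 or C4.
module Dominators {k} (H : Graph k)
  (noP4 : ¬ ContainsInduced H P4Adj) (noC4 : ¬ ContainsInduced H (cycleAdj 4)) where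

  open Neighbourhoods H

  no-induced-P4-path : ∀ {t v x w} → adj H t v ≡ true → Realises H false t x → adj H v x ≡ true →
                       Realises H false v w → adj H x w ≡ true → t ≢ w → ⊥
  no-induced-P4-path {t} {v} {x} {w} tv tx vx vw xw t≢w with adj H t w ≟ᵇ true
  ... | yes tw = noC4 (embed H C4-graph (lookup (t ∷ v ∷ x ∷ w ∷ []))
                         (tv ∷ tx ∷ tw ∷ vx ∷ vw ∷ xw ∷ []))
  ... | no ¬tw = noP4 (embed H P4-graph (lookup (t ∷ v ∷ x ∷ w ∷ []))
                         (tv ∷ tx ∷ (¬-not ¬tw , t≢w) ∷ vx ∷ vw ∷ xw ∷ []))

  neighbourhood-grows : ∀ {v x w} → adj H v x ≡ true → adj H x w ≡ true → ¬ Near v w → N[ v ] ⊂ N[ x ]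
  neighbourhood-grows {v} {x} {w} vx xw ¬vw =
    (λ t∈N[v] → ∈-subsetOf⁺ (near? x) (inherited (∈-subsetOf⁻ (near? v) t∈N[v]))) ,
    w , ∈-subsetOf⁺ (near? x) (inj₂ xw) , (λ w∈N[v] → ¬vw (∈-subsetOf⁻ (near? v) w∈N[v]))
    where
    inherited : ∀ {t} → Near v t → Near x t
    inherited (inj₁ refl) = inj₂ (trans (sym H x v) vx)
    inherited {t} (inj₂ vt) = decidable-stable (near? x t) λ ¬xt →
      no-induced-P4-path (trans (sym H t v) vt) (apart-sym H (¬near⇒apart ¬xt)) vx
        (¬near⇒apart ¬vw) xw (λ { refl → ¬vw (inj₂ vt) })

  dominator-from : ∀ z v → Acc _⊃_ N[ v ] → Connected (adj H) z v → ¬ ¬ ∃ λ u → Dominates u z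
  dominator-from z v (acc larger) zv ¬dom =
    ¬¬-excluded-middle {A = ∃ λ y → Connected (adj H) z y × ¬ Near v y} λ where
      (yes (y , zy , ¬vy)) → leave (connected-trans (connected-sym (sym H) zv) zy) ¬vy
      (no ¬outside)        → ¬dom (v , λ y zy → decidable-stable (near? v y) λ ¬vy → ¬outside (y , zy , ¬vy))
    where
    leave : ∀ {y} → Connected (adj H) v y → ¬ Near v y → ⊥
    leave (_ , walk) ¬vy with boundary-edge (near? v) walk (inj₁ refl) ¬vy
    ... | x , w , inj₁ refl , xw , ¬vw = ¬vw (inj₂ xw)
    ... | x , w , inj₂ vx   , xw , ¬vw =
      dominator-from z x (larger (neighbourhood-grows vx xw ¬vw)) (connected-trans zv (connected-edge vx)) ¬dom

  dominator : ∀ z → ¬ ¬ ∃ λ u → Dominates u z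
  dominator z = dominator-from z z (⊃-wellFounded N[ z ]) connected-refl

-- In a {P4, C4, 2P3}-free graph the labels of any two edges of a clique forest
-- intersect: if they were disjoint, the edges would lie in different
-- components, and each edge yields an induced P3 through a dominating vertex.
module SeparatorsMeet {k} (H : Graph k)
  (noP4 : ¬ ContainsInduced H P4Adj) (noC4 : ¬ ContainsInduced H (cycleAdj 4))
  (no2P3 : ¬ ContainsInduced H twoP3Adj) (T : CliqueForest H) where

  open Neighbourhoods H
  open Cliques H
  open Dominators H noP4 noC4

  Meets : Fin k → Fin (m T) → Set
  Meets z i = ∃ λ y → y ∈ clique T i × Connected (adj H) z y

  meets⇒connected : ∀ {z i y} → Meets z i → y ∈ clique T i → Connected (adj H) z y
  meets⇒connected {i = i} (y′ , y′∈i , zy′) y∈i =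
    connected-trans zy′ (clique-connected (isClique T i) y′∈i y∈i)

  meets-across : ∀ {z a b} → adj (tree T) a b ≡ true → Meets z a → Meets z b
  meets-across {a = a} {b} ab za with Equivalence.to (components T a b) (connected-edge ab)
  ... | x , y , x∈a , y∈b , xy = y , y∈b , connected-trans (meets⇒connected za x∈a) xy

  edge-ends-differ : ∀ {a b} → adj (tree T) a b ≡ true → clique T a ≢ clique T b
  edge-ends-differ {a} ab ca≡cb with injective T ca≡cb
  ... | refl = true≢false ab (irrefl (tree T) a)

  dominator-in-label : ∀ {u z a b} → Dominates u z → adj (tree T) a b ≡ true → Meets z a →
                       u ∈ label T a b
  dominator-in-label {a = a} {b} dom ab za =
    x∈p∩q⁺ (dominator-in-clique dom (isClique T a) za ,
            dominator-in-clique dom (isClique T b) (meets-across ab za))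

  P3-at-edge : ∀ {u z a b} → Dominates u z → adj (tree T) a b ≡ true → Meets z a →
               InducedP3Within (Connected (adj H) z)
  P3-at-edge {a = a} {b} dom ab za =
    separating-P3 (isClique T a) (isClique T b) (edge-ends-differ ab)
      (dominator-in-clique dom (isClique T a) za) (dominator-in-clique dom (isClique T b) zb)
      (meets⇒connected za) (meets⇒connected zb)
    where
    zb = meets-across ab za

  separators-meet : ∀ {a b c d} → adj (tree T) a b ≡ true → adj (tree T) c d ≡ true →
                    Nonempty (label T a b ∩ label T c d)
  separators-meet {a} {b} {c} {d} ab cd = decidable-stable (nonempty? _) λ disjoint →
    dominator z λ (u , u-dom) → dominator z′ λ (_ , u′-dom) →
      no2P3 (two-P3s (apart disjoint u-dom) (P3-at-edge u-dom ab z-meets) (P3-at-edge u′-dom cd z′-meets))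
    where
    z  = proj₁ (proj₁ (isClique T a))
    z′ = proj₁ (proj₁ (isClique T c))
    z-meets : Meets z a
    z-meets = z , proj₂ (proj₁ (isClique T a)) , connected-refl
    z′-meets : Meets z′ c
    z′-meets = z′ , proj₂ (proj₁ (isClique T c)) , connected-refl

    -- If the two components touched, the dominator u would lie in both labels.
    apart : ¬ Nonempty (label T a b ∩ label T c d) → ∀ {u} → Dominates u z →
            ∀ {s t} → Connected (adj H) z s → Connected (adj H) z′ t → Realises H false s t
    apart disjoint {u} dom zs z′t = ¬near⇒apart λ st →
      disjoint (u , x∈p∩q⁺ (dominator-in-label dom ab z-meets , dominator-in-label dom cd
        (z′ , proj₂ (proj₁ (isClique T c)) ,
         connected-trans zs (connected-trans (near⇒connected st) (connected-sym (sym H) z′t)))))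

free⇒separators-meet : ∀ {k} (H : Graph k) → ¬ ContainsInduced H P4Adj → ¬ ContainsInduced H (cycleAdj 4) →
                       ¬ ContainsInduced H twoP3Adj → SeparatorsPairwiseIntersect H
free⇒separators-meet H noP4 noC4 no2P3 T a b c d ab cd _ =
  SeparatorsMeet.separators-meet H noP4 noC4 no2P3 T ab cd

walk-starts : ∀ {m} {A : Fin m → Fin m → Bool} {i j vs} → Walk A i j vs → i List.∈ vs
walk-starts (here _)   = here refl
walk-starts (step _ _) = here refl

walk-invariant : ∀ {m} {A : Fin m → Fin m → Bool} {L : Set} (lab : Fin m → L) →
                 (∀ i j → A i j ≡ true → lab i ≡ lab j) → ∀ {i j} → Connected A i j → lab i ≡ lab j
walk-invariant lab inv (_ , here _) = refl
walk-invariant lab inv (_ , step {i} {j} e w) = trans (inv i j e) (walk-invariant lab inv (_ , w))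

record IsStarForest {m} (T : Graph m) (centre : Fin m → Fin m) : Set where
  field
    centre-idem : ∀ i → centre (centre i) ≡ centre i
    edge⇒centre : ∀ i j → adj T i j ≡ true → centre i ≡ j ⊎ centre j ≡ i
    centre-edge : ∀ i → i ≢ centre i → adj T i (centre i) ≡ true

module StarForest {m} {T : Graph m} {centre : Fin m → Fin m} (star : IsStarForest T centre) where
  open IsStarForest star

  data StarPath (i j : Fin m) : List (Fin m) → Set where
    stay : i ≡ j → StarPath i j (i ∷ [])
    edge : adj T i j ≡ true → StarPath i j (i ∷ j ∷ [])
    via  : adj T i j ≡ false → i ≢ j → StarPath i j (i ∷ centre i ∷ j ∷ [])

  edge-same-centre : ∀ i j → adj T i j ≡ true → centre i ≡ centre j
  edge-same-centre i j ij with edge⇒centre i j ij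
  ... | inj₁ refl = ≡-sym (centre-idem i)
  ... | inj₂ refl = centre-idem j

  middle-is-centre : ∀ {i j k} → adj T i j ≡ true → adj T j k ≡ true → i ≢ k →
                     centre i ≡ j × centre k ≡ j
  middle-is-centre {i} {j} {k} ij jk i≢k with edge⇒centre i j ij | edge⇒centre j k jk
  ... | inj₁ ci≡j | inj₂ ck≡j = ci≡j , ck≡j
  ... | inj₂ refl | inj₁ refl = ⊥-elim (i≢k refl)
  ... | inj₂ refl | inj₂ refl = ⊥-elim (adjacent⇒distinct T ij (centre-idem k))
  ... | inj₁ refl | inj₁ cj≡k = ⊥-elim (adjacent⇒distinct T jk (trans (≡-sym (centre-idem i)) cj≡k))

  -- No path has four vertices: its two middle vertices would both be centres.
  no-long-path : ∀ {i j k l} → adj T i j ≡ true → adj T j k ≡ true → adj T k l ≡ true →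
                 i ≢ k → j ≢ l → ⊥
  no-long-path {i} ij jk kl i≢k j≢l with middle-is-centre ij jk i≢k | middle-is-centre jk kl j≢l
  ... | refl , _ | cj≡k , _ = adjacent⇒distinct T jk (trans (≡-sym (centre-idem i)) cj≡k)

  star-path : ∀ {i j vs} → IsPath (adj T) i j vs → StarPath i j vs
  star-path (here i , _) = stay refl
  star-path (step ij (here _) , _) = edge ij
  star-path (step {i} ij (step jk (here k)) , (i≢j ∷ i≢k ∷ _) ∷ _)
    with middle-is-centre ij jk i≢k
  ... | refl , ck≡j = via (¬-not ¬ik) i≢k
    where
    ¬ik : ¬ (adj T i k ≡ true)
    ¬ik ik with edge⇒centre i k ik
    ... | inj₁ ci≡k = adjacent⇒distinct T jk ci≡k
    ... | inj₂ ck≡i = i≢j (≡-sym (trans (≡-sym ck≡j) ck≡i))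
  star-path (step ij (step jk (step kl w)) , (_ ∷ i≢k ∷ _) ∷ (_ ∷ j≢rest) ∷ _)
    = ⊥-elim (no-long-path ij jk kl i≢k (All.lookup j≢rest (walk-starts w)))

  -- A shape is determined by its ends, so a star forest is a forest.
  star-path-unique : ∀ {i j vs ws} → StarPath i j vs → StarPath i j ws → vs ≡ ws
  star-path-unique (stay _)     (stay _)     = refl
  star-path-unique (stay refl)  (edge ij)    = ⊥-elim (adjacent⇒distinct T ij refl)
  star-path-unique (stay i≡j)   (via _ i≢j)  = ⊥-elim (i≢j i≡j)
  star-path-unique (edge ij)    (stay refl)  = ⊥-elim (adjacent⇒distinct T ij refl)
  star-path-unique (edge _)     (edge _)     = refl
  star-path-unique (edge ij)    (via ¬ij _)  = ⊥-elim (true≢false ij ¬ij)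
  star-path-unique (via _ i≢j)  (stay i≡j)   = ⊥-elim (i≢j i≡j)
  star-path-unique (via ¬ij _)  (edge ij)    = ⊥-elim (true≢false ij ¬ij)
  star-path-unique (via _ _)    (via _ _)    = refl

  star-forest : IsForest T
  star-forest i j vs ws p q = star-path-unique (star-path p) (star-path q)

  star-path-members : ∀ {i j vs l} → StarPath i j vs → l List.∈ vs → l ≡ i ⊎ l ≡ j ⊎ (i ≢ j × l ≡ centre i)
  star-path-members (stay _)    (here l≡i)                 = inj₁ l≡i
  star-path-members (edge _)    (here l≡i)                 = inj₁ l≡i
  star-path-members (edge _)    (there (here l≡j))         = inj₂ (inj₁ l≡j)
  star-path-members (via _ _)   (here l≡i)                 = inj₁ l≡i
  star-path-members (via _ i≢j) (there (here l≡c))         = inj₂ (inj₂ (i≢j , l≡c))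
  star-path-members (via _ _)   (there (there (here l≡j))) = inj₂ (inj₁ l≡j)

  star-connected : ∀ {i j} → Connected (adj T) i j ⇔ centre i ≡ centre j
  star-connected {i} {j} = mk⇔ (walk-invariant centre edge-same-centre)
    λ ci≡cj → connected-trans (to-centre i)
                (subst (λ c → Connected (adj T) c j) (≡-sym ci≡cj) (connected-sym (sym T) (to-centre j)))
    where
    to-centre : ∀ l → Connected (adj T) l (centre l)
    to-centre l with l ≟ centre l
    ... | yes l≡c = subst (Connected (adj T) l) l≡c connected-refl
    ... | no l≢c  = connected-edge (centre-edge l l≢c)

record StarCertificate {n} (G : Graph n) : Set where
  field
    size    : ℕ
    cliques : Fin size → Subset n
    star    : Graph size
    centre  : Fin size → Fin size
    is-star : IsStarForest star centre
    all-cliques : ∀ i → IsClique G (cliques i)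
    distinct    : ∀ i j → cliques i ≡ cliques j → i ≡ j
    listed      : ∀ K → IsClique G K → ∃ λ i → cliques i ≡ K
    -- the components of G match those of the star forest
    edges-covered       : ∀ x y → adj G x y ≡ true → ∃ λ i → x ∈ cliques i × y ∈ cliques i
    overlap⇒same-centre : ∀ i j → Nonempty (cliques i ∩ cliques j) → centre i ≡ centre j
    edges-overlap       : ∀ i j → adj star i j ≡ true → Nonempty (cliques i ∩ cliques j)
    -- the clique-intersection property along leaf - centre - leaf paths
    through-centre : ∀ i j → i ≢ j → cliques i ∩ cliques j ⊆ cliques (centre i)

module Certified {n} {G : Graph n} (cert : StarCertificate G) where
  open StarCertificate cert
  open StarForest is-star
  open Cliques G using (clique-connected)

  walk-same-centre : ∀ {x y vs i j} → Walk (adj G) x y vs → x ∈ cliques i → y ∈ cliques j →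
                     centre i ≡ centre j
  walk-same-centre {i = i} {j} (here x) x∈i x∈j = overlap⇒same-centre i j (x , x∈p∩q⁺ (x∈i , x∈j))
  walk-same-centre {x = x} {i = i} (step {j = x′} xx′ w) x∈i y∈j with edges-covered x x′ xx′
  ... | l , x∈l , x′∈l =
    trans (overlap⇒same-centre i l (x , x∈p∩q⁺ (x∈i , x∈l))) (walk-same-centre w x′∈l y∈j)

  lift-walk : ∀ {i j vs} → Walk (adj star) i j vs → ∀ {x y} → x ∈ cliques i → y ∈ cliques j →
              Connected (adj G) x y
  lift-walk (here i) x∈i y∈i = clique-connected (all-cliques i) x∈i y∈i
  lift-walk (step {i} {i′} e w) x∈i y∈j with edges-overlap i i′ e
  ... | s , s∈both = connected-trans
    (clique-connected (all-cliques i) x∈i (proj₁ (x∈p∩q⁻ (cliques i) (cliques i′) s∈both)))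
    (lift-walk w (proj₂ (x∈p∩q⁻ (cliques i) (cliques i′) s∈both)) y∈j)

  components-match : ∀ i j → Connected (adj star) i j ⇔
                (∃ λ x → ∃ λ y → x ∈ cliques i × y ∈ cliques j × Connected (adj G) x y)
  components-match i j = mk⇔
    (λ { (_ , w) → x , y , x∈i , y∈j , lift-walk w x∈i y∈j })
    (λ { (_ , _ , x∈i , y∈j , (_ , w)) → Equivalence.from star-connected (walk-same-centre w x∈i y∈j) })
    where
    x = proj₁ (proj₁ (all-cliques i))
    x∈i = proj₂ (proj₁ (all-cliques i))
    y = proj₁ (proj₁ (all-cliques j))
    y∈j = proj₂ (proj₁ (all-cliques j))

  -- Along a path only the leaf - centre - leaf case needs an argument.
  path-property : ∀ i j vs → IsPath (adj star) i j vs → ∀ l → l List.∈ vs →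
                  (cliques i ∩ cliques j) ⊆ cliques l
  path-property i j vs p l l∈vs with star-path-members (star-path p) l∈vs
  ... | inj₁ refl               = p∩q⊆p (cliques i) (cliques j)
  ... | inj₂ (inj₁ refl)        = p∩q⊆q (cliques i) (cliques j)
  ... | inj₂ (inj₂ (i≢j , refl)) = through-centre i j i≢j

  clique-forest : CliqueForest G
  clique-forest = record
    { m = size ; clique = cliques ; isClique = all-cliques
    ; injective = λ {i} {j} → distinct i j ; complete = listed
    ; tree = star ; forest = star-forest
    ; components = components-match ; pathProp = path-property }

isClique? : ∀ {n} (G : Graph n) K → Dec (IsClique G K)
isClique? G K =
  nonempty? K
  ×-dec (all? λ x → all? λ y → (x ∈? K) →-dec ((y ∈? K) →-dec (¬? (x ≟ y) →-dec (adj G x y ≟ᵇ true))))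
  ×-dec (all? λ v → ¬? (v ∈? K) →-dec ¬? (all? λ x → (x ∈? K) →-dec (adj G v x ≟ᵇ true)))

listsAllCliques? : ∀ {n m} (G : Graph n) (C : Fin m → Subset n) → Dec (∀ K → IsClique G K → ∃ λ i → C i ≡ K)
listsAllCliques? G C = map′
  (λ none K cK → decidable-stable (listed? K) λ unlisted → none (K , cK , unlisted))
  (λ all (K , cK , unlisted) → unlisted (all K cK))
  (¬? (anySubset? λ K → isClique? G K ×-dec ¬? (listed? K)))
  where
  listed? : ∀ K → Dec (∃ λ i → C i ≡ K)
  listed? K = any? λ i → Vec.≡-dec _≟ᵇ_ (C i) K

-- The clique forest given by a star certificate all of whose conditions are
-- checked by evaluation (in the order of the fields of StarCertificate).
certifiedForest : ∀ {n} (G : Graph n) (size : ℕ) (cliques : Fin size → Subset n) (star : Graph size)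
  (centre : Fin size → Fin size) →
  {_ : True (all? λ i → centre (centre i) ≟ centre i)} →
  {_ : True (all? λ i → all? λ j → (adj star i j ≟ᵇ true) →-dec ((centre i ≟ j) ⊎-dec (centre j ≟ i)))} →
  {_ : True (all? λ i → ¬? (i ≟ centre i) →-dec (adj star i (centre i) ≟ᵇ true))} →
  {_ : True (all? λ i → isClique? G (cliques i))} →
  {_ : True (all? λ i → all? λ j → Vec.≡-dec _≟ᵇ_ (cliques i) (cliques j) →-dec (i ≟ j))} →
  {_ : True (listsAllCliques? G cliques)} →
  {_ : True (all? λ x → all? λ y → (adj G x y ≟ᵇ true) →-dec any? λ i → (x ∈? cliques i) ×-dec (y ∈? cliques i))} →
  {_ : True (all? λ i → all? λ j → nonempty? (cliques i ∩ cliques j) →-dec (centre i ≟ centre j))} →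
  {_ : True (all? λ i → all? λ j → (adj star i j ≟ᵇ true) →-dec nonempty? (cliques i ∩ cliques j))} →
  {_ : True (all? λ i → all? λ j → ¬? (i ≟ j) →-dec (cliques i ∩ cliques j ⊆? cliques (centre i)))} →
  CliqueForest G
certifiedForest G size cliques star centre {c₁} {c₂} {c₃} {c₄} {c₅} {c₆} {c₇} {c₈} {c₉} {c₁₀} =
  Certified.clique-forest record
    { size = size ; cliques = cliques ; star = star ; centre = centre
    ; is-star = record { centre-idem = toWitness c₁ ; edge⇒centre = toWitness c₂ ; centre-edge = toWitness c₃ }
    ; all-cliques = toWitness c₄ ; distinct = toWitness c₅ ; listed = toWitness c₆
    ; edges-covered = toWitness c₇ ; overlap⇒same-centre = toWitness c₈
    ; edges-overlap = toWitness c₉ ; through-centre = toWitness c₁₀ }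

-- P4 = 0 - 1 - 2 - 3 has the cliques {0,1}, {1,2}, {2,3}; they form a path,
-- i.e. a star centred at {1,2}.
P4-forest : CliqueForest P4-graph
P4-forest = certifiedForest P4-graph 3
  (lookup ((true ∷ true ∷ false ∷ false ∷ []) ∷ (false ∷ true ∷ true ∷ false ∷ []) ∷
           (false ∷ false ∷ true ∷ true ∷ []) ∷ []))
  (graphOf (matrixAdj ((false ∷ true ∷ false ∷ []) ∷ (true ∷ false ∷ true ∷ []) ∷
                        (false ∷ true ∷ false ∷ []) ∷ [])))
  (λ _ → 1F)

-- 2P3 = 0 - 1 - 2 , 3 - 4 - 5 has the cliques {0,1}, {1,2}, {3,4}, {4,5};
-- its clique forest has the two edges {0,1} - {1,2} and {3,4} - {4,5}.
2P3-forest : CliqueForest 2P3-graph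
2P3-forest = certifiedForest 2P3-graph 4
  (lookup ((true ∷ true ∷ false ∷ false ∷ false ∷ false ∷ []) ∷ (false ∷ true ∷ true ∷ false ∷ false ∷ false ∷ []) ∷
           (false ∷ false ∷ false ∷ true ∷ true ∷ false ∷ []) ∷ (false ∷ false ∷ false ∷ false ∷ true ∷ true ∷ []) ∷ []))
  (graphOf (matrixAdj ((false ∷ true ∷ false ∷ false ∷ []) ∷ (true ∷ false ∷ false ∷ false ∷ []) ∷
                        (false ∷ false ∷ false ∷ true ∷ []) ∷ (false ∷ false ∷ true ∷ false ∷ []) ∷ [])))
  (lookup (0F ∷ 0F ∷ 2F ∷ 2F ∷ []))

walk-transfer : ∀ {m} {A B : Fin m → Fin m → Bool} → (∀ i j → A i j ≡ B i j) →
                ∀ {i j vs} → Walk A i j vs → Walk B i j vs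
walk-transfer same (here i) = here i
walk-transfer same (step {i} {j} e w) = step (trans (≡-sym (same i j)) e) (walk-transfer same w)

clique-transfer : ∀ {n} (G H : Graph n) → (∀ i j → adj G i j ≡ adj H i j) →
                  ∀ {K} → IsClique G K → IsClique H K
clique-transfer G H same (nonempty , pairwise , maximal) =
  nonempty ,
  (λ x y x∈K y∈K x≢y → trans (≡-sym (same x y)) (pairwise x y x∈K y∈K x≢y)) ,
  (λ v v∉K all-adj → maximal v v∉K λ x x∈K → trans (same v x) (all-adj x x∈K))

transport : ∀ {n} (G H : Graph n) → (∀ i j → adj G i j ≡ adj H i j) → CliqueForest H → CliqueForest G
transport G H same F = record
  { m = m F ; clique = clique F
  ; isClique = clique-transfer H G same′ ∘ isClique F
  ; injective = injective F
  ; complete = λ K → complete F K ∘ clique-transfer G H same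
  ; tree = tree F ; forest = forest F
  ; components = λ i j → mk⇔
      (λ c → let (x , y , x∈i , y∈j , (_ , w)) = Equivalence.to (components F i j) c
             in x , y , x∈i , y∈j , _ , walk-transfer same′ w)
      (λ { (x , y , x∈i , y∈j , (_ , w)) →
             Equivalence.from (components F i j) (x , y , x∈i , y∈j , _ , walk-transfer same w) })
  ; pathProp = pathProp F }
  where
  same′ : ∀ i j → adj H i j ≡ adj G i j
  same′ i j = ≡-sym (same i j)

contains-via-induced : ∀ {n k l} (G : Graph n) (f : Fin k → Fin n) → Injective _≡_ _≡_ f →
                       (A : Fin l → Fin l → Bool) → ContainsInduced (induced G f) A → ContainsInduced G A
contains-via-induced G f f-injective A (g , g-injective , g-adj) = f ∘ g , g-injective ∘ f-injective , g-adj

violates-condition-i : ∀ {n k} (G : Graph n) (P : Graph k) → ContainsInduced G (adj P) →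
                       (F : CliqueForest P) → ∀ a b c d → adj (tree F) a b ≡ true → adj (tree F) c d ≡ true →
                       DistinctEdges a b c d → ¬ Nonempty (label F a b ∩ label F c d) → ¬ ConditionI G
violates-condition-i G P (f , f-injective , f-adj) F a b c d ab cd distinct disjoint condition =
  disjoint (condition _ f f-injective (transport (induced G f) P f-adj F) a b c d ab cd distinct)

P4-labels-disjoint : ¬ Nonempty (label P4-forest 0F 1F ∩ label P4-forest 1F 2F)
P4-labels-disjoint = from-no (nonempty? (label P4-forest 0F 1F ∩ label P4-forest 1F 2F))

2P3-labels-disjoint : ¬ Nonempty (label 2P3-forest 0F 1F ∩ label 2P3-forest 2F 3F)
2P3-labels-disjoint = from-no (nonempty? (label 2P3-forest 0F 1F ∩ label 2P3-forest 2F 3F))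

lemma2p2 : (n : ℕ) (G : Graph n) → Chordal G → (ConditionI G ⇔ P4-2P3-Free G)
lemma2p2 n G chordal = mk⇔ condition-i⇒free free⇒condition-i
  where
  condition-i⇒free : ConditionI G → P4-2P3-Free G
  condition-i⇒free condition =
    (λ P4⊆G → violates-condition-i G P4-graph P4⊆G P4-forest 0F 1F 1F 2F refl refl
                (λ { (inj₁ (() , _)) ; (inj₂ (() , _)) }) P4-labels-disjoint condition) ,
    (λ 2P3⊆G → violates-condition-i G 2P3-graph 2P3⊆G 2P3-forest 0F 1F 2F 3F refl refl
                (λ { (inj₁ (() , _)) ; (inj₂ (() , _)) }) 2P3-labels-disjoint condition)

  free⇒condition-i : P4-2P3-Free G → ConditionI G
  free⇒condition-i (noP4 , no2P3) k f f-injective =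
    free⇒separators-meet (induced G f)
      (noP4 ∘ lift P4Adj) (chordal 4 ≤-refl ∘ lift (cycleAdj 4)) (no2P3 ∘ lift twoP3Adj)
    where
    lift : ∀ {l} (A : Fin l → Fin l → Bool) → ContainsInduced (induced G f) A → ContainsInduced G A
    lift = contains-via-induced G f f-injective
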